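{- For each $t\in\{6,7,8,9,13\}$ there exists a super-simple $(4,2)$-DGDD of type $3^t$ with $d\ge\frac12$.
   Context: A $(4,2)$-DGDD of type $3^t$ is a triple $(X,\mathcal{G},\mathcal{B})$ where $X$ is partitioned into $t$ groups of size $3$ and $\mathcal{B}$ is a collection of ordered $4$-tuples of distinct points such that each ordered pair $(x,y)$ of points from different groups appears in exactly $2$ blocks ($(x,y)$ appears in $(a_1,\dots,a_4)$ if $x=a_i,y=a_j$, $i<j$), and no two points of the same group lie in a common block. It is super-simple if any two blocks, viewed as sets, share at most two points. A defining set is a subset of $\mathcal{B}$ contained in a unique such DGDD with the same points and groups; $d$ is the size of a smallest defining set divided by $|\mathcal{B}|$. -}

module Defs where

open import Data.Nat using (ℕ; _≤_; _*_)
open import Data.Fin using (Fin; _<_; _<?_)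
open import Data.Fin.Properties using (any?) renaming (_≟_ to _≟ᶠ_)
open import Data.Product using (Σ; ∃; _×_; _,_; proj₁)
open import Data.Product.Properties using (≡-dec)
open import Data.Vec using (Vec; lookup)
open import Data.List using (List; length; filter; _++_; allFin)
import Data.List as L
open import Data.List.Relation.Binary.Permutation.Propositional using (_↭_)
open import Data.List.Membership.Propositional using (_∈_)
open import Relation.Nullary using (Dec; ¬_)
open import Relation.Nullary.Decidable using (_×-dec_)
open import Relation.Binary.PropositionalEquality using (_≡_; _≢_)
open import Relation.Binary.Definitions using (DecidableEquality)

Point : ℕ → Set
Point t = Fin t × Fin 3

group : ∀ {t} → Point t → Fin t
group = proj₁

_≟ₚ_ : ∀ {t} → DecidableEquality (Point t)
_≟ₚ_ = ≡-dec _≟ᶠ_ _≟ᶠ_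

Block : ℕ → Set
Block t = Vec (Point t) 4

ValidBlock : ∀ {t} → Block t → Set
ValidBlock b = (i j : Fin 4) → i ≢ j →
  (lookup b i ≢ lookup b j) × (group (lookup b i) ≢ group (lookup b j))

PairIn : ∀ {t} → Point t → Point t → Block t → Set
PairIn x y b = ∃ λ i → ∃ λ j → (i < j) × (lookup b i ≡ x) × (lookup b j ≡ y)

pairIn? : ∀ {t} (x y : Point t) (b : Block t) → Dec (PairIn x y b)
pairIn? x y b = any? λ i → any? λ j → (i <? j) ×-dec ((lookup b i ≟ₚ x) ×-dec (lookup b j ≟ₚ y))

pairCount : ∀ {t} → Point t → Point t → List (Block t) → ℕ
pairCount x y B = length (filter (pairIn? x y) B)

-- (4,2)-DGDD of type 3^t on the point set Point t with groups given by `group`;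
-- the block collection is a list (a multiset of blocks).
IsDGDD : (t : ℕ) → List (Block t) → Set
IsDGDD t B =
  ((b : Block t) → b ∈ B → ValidBlock b) ×
  ((x y : Point t) → group x ≢ group y → pairCount x y B ≡ 2)

-- number of points common to two blocks viewed as sets
-- (entries of a valid block are distinct)
common : ∀ {t} → Block t → Block t → ℕ
common b c = length (filter (λ i → any? λ j → lookup b i ≟ₚ lookup c j) (allFin 4))

SuperSimple : ∀ {t} → List (Block t) → Set
SuperSimple B = (p q : Fin (length B)) → p ≢ q →
  common (L.lookup B p) (L.lookup B q) ≤ 2

_⊆ᵇ_ : ∀ {A : Set} → List A → List A → Set
S ⊆ᵇ B = ∃ λ R → (S L.++ R) ↭ B

IsDefiningSet : (t : ℕ) → List (Block t) → List (Block t) → Set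
IsDefiningSet t S B = (S ⊆ᵇ B) ×
  ((B' : List (Block t)) → IsDGDD t B' → S ⊆ᵇ B' → B' ↭ B)

HasDAtLeastHalf : (t : ℕ) → List (Block t) → Set
HasDAtLeastHalf t B = (S : List (Block t)) → IsDefiningSet t S B → length B ≤ 2 * length S

module Submission where

-- Each design B below is a union of trades {(x,y,a,b), (y,x,c,d)}. Exchanging x and y in both
-- blocks of a trade only moves the ordered pair (x,y) from the first block to the second and
-- (y,x) the other way, so all pair counts are preserved and the result is again a DGDD. It
-- differs from B, because super-simplicity keeps (y,x,a,b), which shares four points with
-- (x,y,a,b), out of B. Hence a defining set S, which determines B, must contain a block of every
-- trade, and |B| ≤ 2|S|. The designs are cyclic over ℤ₃ₜ, with the residue classes mod t as
-- groups; they are developed from a few base trades and checked by computation.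

open import Defs

open import Data.Bool using (Bool; true; false; T; T?; _∧_; _∨_; if_then_else_)
open import Data.Bool.ListAction using (any; all)
open import Data.Bool.Properties using (T-∧; ∨-identityʳ)
open import Data.Bool.Solver using (module ∨-∧-Solver)
open import Data.Empty using (⊥-elim)
open import Data.Fin as Fin using (Fin; zero; suc; toℕ; fromℕ<; remQuot; combine) renaming (_≟_ to _≟ᶠ_)
open import Data.Fin.Patterns using (0F; 1F; 2F; 3F)
import Data.Fin.Properties as Finₚ
open import Data.List using (List; []; _∷_; _++_; [_]; length; filter; filterᵇ; map; concatMap; allFin; upTo)
import Data.List as List
open import Data.List.Membership.Propositional using (_∈_; _∉_; lose)
open import Data.List.Membership.Propositional.Properties
  using (∈-∃++; ∈-++⁻; ∈-++⁺ʳ; ∈-allFin; ∈-filter⁺; ∈-map⁻; ∈-lookup)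
import Data.List.Membership.DecPropositional as DecMembership
open import Data.List.Properties
  using (filter-++; filter-accept; filter-reject; filter-all; length-++; tabulate-lookup)
open import Data.List.Relation.Binary.Permutation.Propositional
  using (_↭_; ↭-sym; prep; module PermutationReasoning)
open import Data.List.Relation.Binary.Permutation.Propositional.Properties
  using (∈-resp-↭; All-resp-↭; ↭-length; filter-↭; shift; shifts; ++⁺ˡ)
open import Data.List.Relation.Unary.All as All using (All; []; _∷_)
open import Data.List.Relation.Unary.All.Properties using (all⁺)
open import Data.List.Relation.Unary.AllPairs as AllPairs using (AllPairs; []; _∷_)
import Data.List.Relation.Unary.AllPairs.Properties as AllPairsₚ
open import Data.List.Relation.Unary.Any as Any using (Any; here; there; index; satisfied)
open import Data.List.Relation.Unary.Any.Properties using (lookup-index; any⁺; any⁻)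
import Data.List.Relation.Unary.Any.Properties as Anyₚ
open import Data.List.Relation.Unary.Unique.Propositional using (Unique)
open import Data.Nat
  using (ℕ; suc; _+_; _*_; _%_; _≤_; _<_; _≤?_; _≤ᵇ_; _≡ᵇ_; NonZero; z≤n; s≤s; z<s; s<s)
  renaming (_≟_ to _≟ℕ_)
open import Data.Nat.DivMod using (m%n<n)
open import Data.Nat.Properties
  using (≤-trans; ≤-reflexive; *-monoʳ-≤; *-suc; ≡ᵇ⇒≡; ≡⇒≡ᵇ; ≤ᵇ⇒≤; ≤⇒≤ᵇ; module ≤-Reasoning)
open import Data.Product using (∃; _×_; _,_; proj₁; proj₂; swap; uncurry)
import Data.Product as Product
open import Data.Product.Properties using (≡-dec; ×-≡,≡→≡; ×-≡,≡←≡)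
open import Data.Sum using (_⊎_; inj₁; inj₂; [_,_]′)
import Data.Sum as Sum
open import Data.Unit using (tt)
open import Data.Vec using (Vec; _∷_; []; lookup; toList)
import Data.Vec as Vec
open import Data.Vec.Properties using (lookup-map)
import Data.Vec.Properties as Vecₚ
open import Function using (_∘_; id; _⇔_; mk⇔; Equivalence)
open import Relation.Binary.Definitions using (tri<; tri≈; tri>)
open import Relation.Binary.PropositionalEquality
  using (_≡_; _≢_; refl; sym; trans; cong; cong₂; subst; subst₂; ≢-sym; module ≡-Reasoning)
open import Relation.Nullary using (¬_; Dec; yes; no; ¬?)
open import Relation.Nullary.Decidable using (True; toWitness; map′; _×-dec_; _→-dec_)

module _ {A : Set} where

  ∈⇒↭∷ : ∀ {x : A} {xs} → x ∈ xs → ∃ λ ys → xs ↭ x ∷ ys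
  ∈⇒↭∷ x∈xs with ys , zs , refl ← ∈-∃++ x∈xs = ys ++ zs , shift _ ys zs

  ∈-++-∉ : ∀ {x : A} xs {ys} → x ∈ xs ++ ys → x ∉ xs → x ∈ ys
  ∈-++-∉ xs x∈ x∉xs with ∈-++⁻ xs x∈
  ... | inj₁ x∈xs = ⊥-elim (x∉xs x∈xs)
  ... | inj₂ x∈ys = x∈ys

  ∈-∷-≢ : ∀ {x y : A} {xs} → x ∈ y ∷ xs → x ≢ y → x ∈ xs
  ∈-∷-≢ (here x≡y)   x≢y = ⊥-elim (x≢y x≡y)
  ∈-∷-≢ (there x∈xs) _   = x∈xs

  ↭-extract₂ : ∀ {S R B : List A} {b₁ b₂} → S ++ R ↭ B → b₁ ∈ B → b₂ ∈ B → b₁ ∉ S → b₂ ∉ S → b₁ ≢ b₂ →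
               ∃ λ R₀ → B ↭ b₁ ∷ b₂ ∷ S ++ R₀
  ↭-extract₂ {S} {R} {B} {b₁} {b₂} S++R↭B b₁∈B b₂∈B b₁∉S b₂∉S b₁≢b₂
    with R₁ , R↭b₁∷R₁ ← ∈⇒↭∷ (∈-++-∉ S (∈-resp-↭ (↭-sym S++R↭B) b₁∈B) b₁∉S)
    with R₀ , R₁↭b₂∷R₀ ← ∈⇒↭∷ (∈-∷-≢ (∈-resp-↭ R↭b₁∷R₁ (∈-++-∉ S (∈-resp-↭ (↭-sym S++R↭B) b₂∈B) b₂∉S))
                                        (≢-sym b₁≢b₂))
    = R₀ , (begin
        B                 ↭⟨ ↭-sym S++R↭B ⟩
        S ++ R            ↭⟨ ++⁺ˡ S R↭b₁∷R₁ ⟩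
        S ++ b₁ ∷ R₁      ↭⟨ ++⁺ˡ S (prep b₁ R₁↭b₂∷R₀) ⟩
        S ++ b₁ ∷ b₂ ∷ R₀ ↭⟨ shifts S (b₁ ∷ b₂ ∷ []) ⟩
        b₁ ∷ b₂ ∷ S ++ R₀ ∎)
    where open PermutationReasoning

  count : (A → Bool) → List A → ℕ
  count p []       = 0
  count p (x ∷ xs) = if p x then suc (count p xs) else count p xs

  count-filterᵇ : ∀ {p q : A → Bool} → (∀ x → T (p x) → T (q x)) → ∀ xs → count p (filterᵇ q xs) ≡ count p xs
  count-filterᵇ p⇒q [] = refl
  count-filterᵇ {p} {q} p⇒q (x ∷ xs) with q x in qx
  ... | true  with p x
  ...   | true  = cong suc (count-filterᵇ p⇒q xs)
  ...   | false = count-filterᵇ p⇒q xs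
  count-filterᵇ {p} {q} p⇒q (x ∷ xs) | false with p x in px
  ...   | true  = ⊥-elim (subst T qx (p⇒q x (subst T (sym px) tt)))
  ...   | false = count-filterᵇ p⇒q xs

  count≢0⇒Any : ∀ {p : A → Bool} xs → count p xs ≢ 0 → Any (T ∘ p) xs
  count≢0⇒Any [] count≢0 = ⊥-elim (count≢0 refl)
  count≢0⇒Any {p} (x ∷ xs) count≢0 with p x in px
  ... | true  = here (subst T (sym px) tt)
  ... | false = there (count≢0⇒Any xs count≢0)

  allPairsᵇ : (A → A → Bool) → List A → Bool
  allPairsᵇ r []       = true
  allPairsᵇ r (x ∷ xs) = all (r x) xs ∧ allPairsᵇ r xs

  allPairsᵇ-sound : ∀ (r : A → A → Bool) xs → T (allPairsᵇ r xs) → AllPairs (λ a b → T (r a b)) xs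
  allPairsᵇ-sound r [] _ = []
  allPairsᵇ-sound r (x ∷ xs) rxs with rx , rxs′ ← Equivalence.to T-∧ rxs =
    all⁺ (r x) xs rx ∷ allPairsᵇ-sound r xs rxs′

  AllPairs-lookup : ∀ {R : A → A → Set} → (∀ {a b} → R a b → R b a) → ∀ {xs} → AllPairs R xs →
                    ∀ i j → i ≢ j → R (List.lookup xs i) (List.lookup xs j)
  AllPairs-lookup sym (_ ∷ _)     zero    zero    i≢j = ⊥-elim (i≢j refl)
  AllPairs-lookup sym (Rx ∷ _)    zero    (suc j) _   = All.lookup Rx (∈-lookup j)
  AllPairs-lookup sym (Rx ∷ _)    (suc i) zero    _   = sym (All.lookup Rx (∈-lookup i))
  AllPairs-lookup sym (_ ∷ pairs) (suc i) (suc j) i≢j = AllPairs-lookup sym pairs i j (i≢j ∘ cong suc)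

  AllPairs-local : ∀ {I : Set} {R : A → A → Set} → (∀ a b → Dec (R a b)) → (near : I → A → Bool) →
                   (∀ {a b} → ¬ R a b → ∃ λ i → T (near i a) × T (near i b)) →
                   ∀ xs → (∀ i → AllPairs R (filterᵇ (near i) xs)) → AllPairs R xs
  AllPairs-local R? near shared [] _ = []
  AllPairs-local {R = R} R? near shared (x ∷ xs) local =
    All.tabulate related ∷ AllPairs-local R? near shared xs local′
    where
      local′ : ∀ i → AllPairs R (filterᵇ (near i) xs)
      local′ i with near i x | local i
      ... | true  | _ ∷ pairs = pairs
      ... | false | pairs     = pairs
      related : ∀ {y} → y ∈ xs → R x y
      related {y} y∈xs with R? x y
      ... | yes Rxy = Rxy
      ... | no ¬Rxy with i , near-x , near-y ← shared ¬Rxy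
        with Rx ∷ _ ← subst (AllPairs R) (filter-accept (T? ∘ near i) {x} {xs} near-x) (local i)
        = All.lookup Rx (∈-filter⁺ (T? ∘ near i) y∈xs near-y)

module _ {A B : Set} {P : B → Set} (P? : ∀ y → Dec (P y)) (f : A → B) (p : A → Bool)
         (p⇔P : ∀ x → T (p x) ⇔ P (f x)) where

  length-filter-map : ∀ xs → length (filter P? (map f xs)) ≡ count p xs
  length-filter-map [] = refl
  length-filter-map (x ∷ xs) with P? (f x) | p x in px
  ... | yes _   | true  = cong suc (length-filter-map xs)
  ... | no _    | false = length-filter-map xs
  ... | yes Pfx | false = ⊥-elim (subst T px (Equivalence.from (p⇔P x) Pfx))
  ... | no ¬Pfx | true  = ⊥-elim (¬Pfx (Equivalence.to (p⇔P x) (subst T (sym px) tt)))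

module _ {X A : Set} (f g : X → A) where

  flatten : List X → List A
  flatten = concatMap λ x → f x ∷ g x ∷ []

  length-flatten : ∀ xs → length (flatten xs) ≡ 2 * length xs
  length-flatten []       = refl
  length-flatten (x ∷ xs) = trans (cong (2 +_) (length-flatten xs)) (sym (*-suc 2 (length xs)))

  ∈-flatten : ∀ {x xs} → x ∈ xs → f x ∈ flatten xs × g x ∈ flatten xs
  ∈-flatten (here refl)  = here refl , there (here refl)
  ∈-flatten (there x∈xs) = Product.map (there ∘ there) (there ∘ there) (∈-flatten x∈xs)

  flatten-distinct : ∀ {x xs} → Unique (flatten xs) → x ∈ xs → f x ≢ g x
  flatten-distinct ((f≢g ∷ _) ∷ _) (here refl)  = f≢g
  flatten-distinct (_ ∷ _ ∷ unique) (there x∈xs) = flatten-distinct unique x∈xs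

  hitting-set-bound : ∀ {S : List A} xs → Unique (flatten xs) → All (λ x → f x ∈ S ⊎ g x ∈ S) xs →
                      length xs ≤ length S
  hitting-set-bound [] _ _ = z≤n
  hitting-set-bound {S} (x ∷ xs) ((_ ∷ f∉) ∷ g∉ ∷ unique) (hit ∷ hits) = [ meets f∉ , meets g∉ ]′ hit
    where
      meets : ∀ {s} → All (s ≢_) (flatten xs) → s ∈ S → suc (length xs) ≤ length S
      meets s∉ s∈S with S′ , S↭s∷S′ ← ∈⇒↭∷ s∈S =
        ≤-trans (s≤s (hitting-set-bound xs unique hits′)) (≤-reflexive (sym (↭-length S↭s∷S′)))
        where
          shrink : ∀ {z} → z ∈ flatten xs → z ∈ S → z ∈ S′
          shrink z∈ z∈S with ∈-resp-↭ S↭s∷S′ z∈S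
          ... | here refl  = ⊥-elim (All.lookup s∉ z∈ refl)
          ... | there z∈S′ = z∈S′
          hits′ : All (λ y → f y ∈ S′ ⊎ g y ∈ S′) xs
          hits′ = All.tabulate λ y∈ →
            Sum.map (shrink (proj₁ (∈-flatten y∈))) (shrink (proj₂ (∈-flatten y∈))) (All.lookup hits y∈)

pairs : ∀ {A : Set} → Vec A 4 → List (A × A)
pairs (p ∷ q ∷ r ∷ s ∷ []) = (p , q) ∷ (p , r) ∷ (p , s) ∷ (q , r) ∷ (q , s) ∷ (r , s) ∷ []

swap₀₁ : ∀ {A : Set} → Vec A 4 → Vec A 4
swap₀₁ (p ∷ q ∷ rest) = q ∷ p ∷ rest

pairs-swap₀₁ : ∀ {A : Set} (b : Vec A 4) → List.drop 1 (pairs (swap₀₁ b)) ↭ List.drop 1 (pairs b)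
pairs-swap₀₁ (p ∷ q ∷ r ∷ s ∷ []) = shifts ((q , r) ∷ (q , s) ∷ []) ((p , r) ∷ (p , s) ∷ [])

4≰2 : ¬ 4 ≤ 2
4≰2 (s≤s (s≤s ()))

module _ {t : ℕ} where

  PairIn⇒∈pairs : ∀ {u v : Point t} b → PairIn u v b → (u , v) ∈ pairs b
  PairIn⇒∈pairs (_ ∷ _ ∷ _ ∷ _ ∷ []) (0F , 1F , _ , refl , refl) = here refl
  PairIn⇒∈pairs (_ ∷ _ ∷ _ ∷ _ ∷ []) (0F , 2F , _ , refl , refl) = there (here refl)
  PairIn⇒∈pairs (_ ∷ _ ∷ _ ∷ _ ∷ []) (0F , 3F , _ , refl , refl) = there (there (here refl))
  PairIn⇒∈pairs (_ ∷ _ ∷ _ ∷ _ ∷ []) (1F , 2F , _ , refl , refl) = there (there (there (here refl)))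
  PairIn⇒∈pairs (_ ∷ _ ∷ _ ∷ _ ∷ []) (1F , 3F , _ , refl , refl) = there (there (there (there (here refl))))
  PairIn⇒∈pairs (_ ∷ _ ∷ _ ∷ _ ∷ []) (2F , 3F , _ , refl , refl) =
    there (there (there (there (there (here refl)))))
  PairIn⇒∈pairs (_ ∷ _ ∷ _ ∷ _ ∷ []) (_             , 0F , ()                 , _)
  PairIn⇒∈pairs (_ ∷ _ ∷ _ ∷ _ ∷ []) (suc _         , 1F , s<s ()             , _)
  PairIn⇒∈pairs (_ ∷ _ ∷ _ ∷ _ ∷ []) (suc (suc _)   , 2F , s<s (s<s ())       , _)
  PairIn⇒∈pairs (_ ∷ _ ∷ _ ∷ _ ∷ []) (3F            , 3F , s<s (s<s (s<s ())) , _)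

  ∈pairs⇒PairIn : ∀ {u v : Point t} b → (u , v) ∈ pairs b → PairIn u v b
  ∈pairs⇒PairIn (_ ∷ _ ∷ _ ∷ _ ∷ []) (here refl)                         = 0F , 1F , z<s , refl , refl
  ∈pairs⇒PairIn (_ ∷ _ ∷ _ ∷ _ ∷ []) (there (here refl))                 = 0F , 2F , z<s , refl , refl
  ∈pairs⇒PairIn (_ ∷ _ ∷ _ ∷ _ ∷ []) (there (there (here refl)))         = 0F , 3F , z<s , refl , refl
  ∈pairs⇒PairIn (_ ∷ _ ∷ _ ∷ _ ∷ []) (there (there (there (here refl)))) = 1F , 2F , s<s z<s , refl , refl
  ∈pairs⇒PairIn (_ ∷ _ ∷ _ ∷ _ ∷ []) (there (there (there (there (here refl))))) =
    1F , 3F , s<s z<s , refl , refl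
  ∈pairs⇒PairIn (_ ∷ _ ∷ _ ∷ _ ∷ []) (there (there (there (there (there (here refl)))))) =
    2F , 3F , s<s (s<s z<s) , refl , refl

  DifferentGroups : Point t × Point t → Set
  DifferentGroups (p , q) = group p ≢ group q

  ValidBlock⇔pairs : (b : Block t) → ValidBlock b ⇔ All DifferentGroups (pairs b)
  ValidBlock⇔pairs b = mk⇔ to from
    where
      to : ValidBlock b → All DifferentGroups (pairs b)
      to valid = All.tabulate λ pq∈ → differ (∈pairs⇒PairIn b pq∈)
        where
          differ : ∀ {p q} → PairIn p q b → group p ≢ group q
          differ (i , j , i<j , refl , refl) = proj₂ (valid i j (Finₚ.<⇒≢ i<j))
      separate : ∀ {p q : Point t} → group p ≢ group q → p ≢ q × group p ≢ group q
      separate gp≢gq = (λ p≡q → gp≢gq (cong group p≡q)) , gp≢gq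
      from : All DifferentGroups (pairs b) → ValidBlock b
      from differ i j i≢j with Finₚ.<-cmp i j
      ... | tri< i<j _ _ = separate (All.lookup differ (PairIn⇒∈pairs b (i , j , i<j , refl , refl)))
      ... | tri≈ _ i≡j _ = ⊥-elim (i≢j i≡j)
      ... | tri> _ _ j<i = separate (≢-sym (All.lookup differ (PairIn⇒∈pairs b (j , i , j<i , refl , refl))))

  ValidBlock-swap₀₁ : ∀ (b : Block t) → ValidBlock b → ValidBlock (swap₀₁ b)
  ValidBlock-swap₀₁ b@(_ ∷ _ ∷ _ ∷ _ ∷ []) valid
    with differ ∷ differs ← Equivalence.to (ValidBlock⇔pairs b) valid =
    Equivalence.from (ValidBlock⇔pairs (swap₀₁ b))
      (≢-sym differ ∷ All-resp-↭ (↭-sym (pairs-swap₀₁ b)) differs)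

  PairIn-swap₀₁ : ∀ {u v : Point t} b → (lookup b 0F , lookup b 1F) ≢ (u , v) →
                  PairIn u v b → PairIn u v (swap₀₁ b)
  PairIn-swap₀₁ b@(_ ∷ _ ∷ _ ∷ _ ∷ []) b₀b₁≢uv uv∈b with PairIn⇒∈pairs b uv∈b
  ... | here uv≡b₀b₁ = ⊥-elim (b₀b₁≢uv (sym uv≡b₀b₁))
  ... | there uv∈    = ∈pairs⇒PairIn (swap₀₁ b) (there (∈-resp-↭ (↭-sym (pairs-swap₀₁ b)) uv∈))

  lookup-injective : ∀ {b : Block t} → ValidBlock b → ∀ i j → lookup b i ≡ lookup b j → i ≡ j
  lookup-injective valid i j bi≡bj with i ≟ᶠ j
  ... | yes i≡j = i≡j
  ... | no  i≢j = ⊥-elim (proj₁ (valid i j i≢j) bi≡bj)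

  ¬PairIn-reversed : ∀ (b : Block t) {i j} → ValidBlock b → i Fin.< j → ¬ PairIn (lookup b j) (lookup b i) b
  ¬PairIn-reversed b {i} {j} valid i<j (k , l , k<l , bk≡bj , bl≡bi)
    with refl ← lookup-injective {b} valid k j bk≡bj | refl ← lookup-injective {b} valid l i bl≡bi =
    Finₚ.<-asym i<j k<l

  pairCount-++ : ∀ (u v : Point t) B C → pairCount u v (B ++ C) ≡ pairCount u v B + pairCount u v C
  pairCount-++ u v B C =
    trans (cong length (filter-++ (pairIn? u v) B C)) (length-++ (filter (pairIn? u v) B))

  pairCount-↭ : ∀ (u v : Point t) {B C} → B ↭ C → pairCount u v B ≡ pairCount u v C
  pairCount-↭ u v B↭C = ↭-length (filter-↭ (pairIn? u v) B↭C)

  pairCount-accept : ∀ {u v : Point t} b → PairIn u v b → pairCount u v [ b ] ≡ 1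
  pairCount-accept b uv∈b = cong length (filter-accept (pairIn? _ _) {b} {[]} uv∈b)

  pairCount-reject : ∀ {u v : Point t} b → ¬ PairIn u v b → pairCount u v [ b ] ≡ 0
  pairCount-reject b uv∉b = cong length (filter-reject (pairIn? _ _) {b} {[]} uv∉b)

  pairCount-swap₀₁ : ∀ {u v : Point t} b → (lookup b 0F , lookup b 1F) ≢ (u , v) →
                     (lookup b 1F , lookup b 0F) ≢ (u , v) → pairCount u v [ swap₀₁ b ] ≡ pairCount u v [ b ]
  pairCount-swap₀₁ {u} {v} b@(_ ∷ _ ∷ _ ∷ _ ∷ []) b₀b₁≢uv b₁b₀≢uv with pairIn? u v b
  ... | yes uv∈b = trans (pairCount-accept (swap₀₁ b) (PairIn-swap₀₁ b b₀b₁≢uv uv∈b))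
                         (sym (pairCount-accept b uv∈b))
  ... | no uv∉b  = trans (pairCount-reject (swap₀₁ b) (uv∉b ∘ PairIn-swap₀₁ (swap₀₁ b) b₁b₀≢uv))
                         (sym (pairCount-reject b uv∉b))

  common-⊆ : ∀ (b c : Block t) → (∀ i → ∃ λ j → lookup b i ≡ lookup c j) → common b c ≡ 4
  common-⊆ b c b⊆c =
    cong length (filter-all (λ i → Finₚ.any? λ j → lookup b i ≟ₚ lookup c j) (All.tabulate λ {i} _ → b⊆c i))

  common-swap₀₁ : ∀ (b : Block t) → common b (swap₀₁ b) ≡ 4
  common-swap₀₁ b@(_ ∷ _ ∷ _ ∷ _ ∷ []) = common-⊆ b (swap₀₁ b) λ where
    0F → 1F , refl
    1F → 0F , refl
    2F → 2F , refl
    3F → 3F , refl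

  FewCommon : Block t → Block t → Set
  FewCommon b c = common b c ≤ 2 × common c b ≤ 2

  AllPairs⇒SuperSimple : ∀ {B : List (Block t)} → AllPairs FewCommon B → SuperSimple B
  AllPairs⇒SuperSimple few p q p≢q = proj₁ (AllPairs-lookup {R = FewCommon} swap few p q p≢q)

  SuperSimple-∈ : ∀ {B : List (Block t)} → SuperSimple B → ∀ {b c} → b ∈ B → c ∈ B → b ≢ c → common b c ≤ 2
  SuperSimple-∈ {B} superSimple b∈B c∈B b≢c =
    subst₂ (λ b c → common b c ≤ 2) (sym (lookup-index b∈B)) (sym (lookup-index c∈B))
      (superSimple (index b∈B) (index c∈B) λ i≡j →
        b≢c (trans (lookup-index b∈B) (trans (cong (List.lookup B) i≡j) (sym (lookup-index c∈B)))))

  SuperSimple⇒Unique : ∀ {B : List (Block t)} → SuperSimple B → Unique B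
  SuperSimple⇒Unique {B} superSimple = subst Unique (tabulate-lookup B) (AllPairsₚ.tabulate⁺ distinct)
    where
      distinct : ∀ {i j} → i ≢ j → List.lookup B i ≢ List.lookup B j
      distinct {i} {j} i≢j Bi≡Bj = 4≰2 (subst (_≤ 2)
        (common-⊆ (List.lookup B i) (List.lookup B j) λ k → k , cong (λ b → lookup b k) Bi≡Bj)
        (superSimple i j i≢j))

  IsDGDD-resp-↭ : ∀ {B C} → B ↭ C → IsDGDD t B → IsDGDD t C
  IsDGDD-resp-↭ B↭C (valid , counts) =
    (λ b b∈C → valid b (∈-resp-↭ (↭-sym B↭C) b∈C)) ,
    (λ x y gx≢gy → trans (sym (pairCount-↭ x y B↭C)) (counts x y gx≢gy))

  IsDGDD-trade : ∀ T {R T′} → IsDGDD t (T ++ R) → All ValidBlock T′ →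
                 (∀ u v → pairCount u v T′ ≡ pairCount u v T) → IsDGDD t (T′ ++ R)
  IsDGDD-trade T {R} {T′} (valid , counts) valid′ sameCounts = valid″ , counts′
    where
      valid″ : ∀ b → b ∈ T′ ++ R → ValidBlock b
      valid″ b b∈ with ∈-++⁻ T′ b∈
      ... | inj₁ b∈T′ = All.lookup valid′ b∈T′
      ... | inj₂ b∈R  = valid b (∈-++⁺ʳ T b∈R)
      counts′ : ∀ x y → group x ≢ group y → pairCount x y (T′ ++ R) ≡ 2
      counts′ x y gx≢gy = begin
        pairCount x y (T′ ++ R)            ≡⟨ pairCount-++ x y T′ R ⟩
        pairCount x y T′ + pairCount x y R ≡⟨ cong (_+ pairCount x y R) (sameCounts x y) ⟩
        pairCount x y T + pairCount x y R  ≡⟨ pairCount-++ x y T R ⟨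
        pairCount x y (T ++ R)             ≡⟨ counts x y gx≢gy ⟩
        2                                  ∎
        where open ≡-Reasoning

record Trade (P : Set) : Set where
  constructor trade
  field
    x y a b c d : P

  block₁ block₂ : Vec P 4
  block₁ = x ∷ y ∷ a ∷ b ∷ []
  block₂ = y ∷ x ∷ c ∷ d ∷ []

open Trade using (block₁; block₂)

tradeBlocks : ∀ {P : Set} → List (Trade P) → List (Vec P 4)
tradeBlocks = flatten block₁ block₂

module _ {t : ℕ} where

  pairCount-swap₀₁-trade : ∀ (τ : Trade (Point t)) → ValidBlock (block₁ τ) → ValidBlock (block₂ τ) → ∀ u v →
    pairCount u v (swap₀₁ (block₁ τ) ∷ swap₀₁ (block₂ τ) ∷ []) ≡ pairCount u v (block₁ τ ∷ block₂ τ ∷ [])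
  pairCount-swap₀₁-trade τ@(trade x y _ _ _ _) valid₁ valid₂ u v = begin
    pairCount u v (b₁′ ∷ b₂′ ∷ [])                ≡⟨ pairCount-++ u v [ b₁′ ] [ b₂′ ] ⟩
    pairCount u v [ b₁′ ] + pairCount u v [ b₂′ ] ≡⟨ exchange (≡-dec _≟ₚ_ _≟ₚ_ (u , v) (x , y))
                                                              (≡-dec _≟ₚ_ _≟ₚ_ (u , v) (y , x)) ⟩
    pairCount u v [ b₁ ] + pairCount u v [ b₂ ]   ≡⟨ pairCount-++ u v [ b₁ ] [ b₂ ] ⟨
    pairCount u v (b₁ ∷ b₂ ∷ [])                  ∎
    where
      open ≡-Reasoning
      b₁ = block₁ τ
      b₂ = block₂ τ
      b₁′ = swap₀₁ b₁
      b₂′ = swap₀₁ b₂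
      reversed : ∀ b → ValidBlock b → pairCount (lookup b 1F) (lookup b 0F) [ b ] ≡ 0
      reversed b valid = pairCount-reject b (¬PairIn-reversed b {0F} {1F} valid z<s)
      inOrder : ∀ b → pairCount (lookup b 0F) (lookup b 1F) [ b ] ≡ 1
      inOrder b = pairCount-accept b (0F , 1F , z<s , refl , refl)
      exchange : Dec ((u , v) ≡ (x , y)) → Dec ((u , v) ≡ (y , x)) →
                 pairCount u v [ b₁′ ] + pairCount u v [ b₂′ ] ≡ pairCount u v [ b₁ ] + pairCount u v [ b₂ ]
      exchange (yes refl) _ =
        trans (cong₂ _+_ (reversed b₁′ (ValidBlock-swap₀₁ b₁ valid₁)) (inOrder b₂′))
              (sym (cong₂ _+_ (inOrder b₁) (reversed b₂ valid₂)))
      exchange (no _) (yes refl) =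
        trans (cong₂ _+_ (inOrder b₁′) (reversed b₂′ (ValidBlock-swap₀₁ b₂ valid₂)))
              (sym (cong₂ _+_ (reversed b₁ valid₁) (inOrder b₂)))
      exchange (no uv≢xy) (no uv≢yx) =
        cong₂ _+_ (pairCount-swap₀₁ b₁ (≢-sym uv≢xy) (≢-sym uv≢yx))
                  (pairCount-swap₀₁ b₂ (≢-sym uv≢yx) (≢-sym uv≢xy))

module _ {t : ℕ} {B S : List (Block t)} (dgdd : IsDGDD t B) (defining : IsDefiningSet t S B) where

  open DecMembership (Vecₚ.≡-dec {n = 4} (_≟ₚ_ {t})) using (_∈?_)

  definingSet-meets-trade : ∀ (τ : Trade (Point t)) → block₁ τ ∈ B → block₂ τ ∈ B → block₁ τ ≢ block₂ τ →
                            swap₀₁ (block₁ τ) ∉ B → block₁ τ ∈ S ⊎ block₂ τ ∈ S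
  definingSet-meets-trade τ b₁∈B b₂∈B b₁≢b₂ b₁′∉B with block₁ τ ∈? S | block₂ τ ∈? S
  ... | yes b₁∈S | _        = inj₁ b₁∈S
  ... | no _     | yes b₂∈S = inj₂ b₂∈S
  ... | no b₁∉S  | no b₂∉S
    with R₀ , B↭b₁∷b₂∷S++R₀ ← ↭-extract₂ (proj₂ (proj₁ defining)) b₁∈B b₂∈B b₁∉S b₂∉S b₁≢b₂ =
    ⊥-elim (b₁′∉B (∈-resp-↭ (proj₂ defining B′ B′-dgdd S⊆B′) (here refl)))
    where
      b₁ = block₁ τ
      b₂ = block₂ τ
      B′ = swap₀₁ b₁ ∷ swap₀₁ b₂ ∷ S ++ R₀
      valid₁ = proj₁ dgdd b₁ b₁∈B
      valid₂ = proj₁ dgdd b₂ b₂∈B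
      B′-dgdd : IsDGDD t B′
      B′-dgdd = IsDGDD-trade (b₁ ∷ b₂ ∷ []) (IsDGDD-resp-↭ B↭b₁∷b₂∷S++R₀ dgdd)
        (ValidBlock-swap₀₁ b₁ valid₁ ∷ ValidBlock-swap₀₁ b₂ valid₂ ∷ [])
        (pairCount-swap₀₁-trade τ valid₁ valid₂)
      S⊆B′ : S ⊆ᵇ B′
      S⊆B′ = swap₀₁ b₁ ∷ swap₀₁ b₂ ∷ R₀ , shifts S (swap₀₁ b₁ ∷ swap₀₁ b₂ ∷ [])

module _ {t : ℕ} (τs : List (Trade (Point t))) (dgdd : IsDGDD t (tradeBlocks τs))
         (superSimple : SuperSimple (tradeBlocks τs)) where

  tradeBlocks-d≥½ : HasDAtLeastHalf t (tradeBlocks τs)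
  tradeBlocks-d≥½ S defining = begin
    length (tradeBlocks τs) ≡⟨ length-flatten block₁ block₂ τs ⟩
    2 * length τs           ≤⟨ *-monoʳ-≤ 2 (hitting-set-bound block₁ block₂ τs unique (All.tabulate meets)) ⟩
    2 * length S            ∎
    where
      open ≤-Reasoning
      unique = SuperSimple⇒Unique superSimple
      meets : ∀ {τ} → τ ∈ τs → block₁ τ ∈ S ⊎ block₂ τ ∈ S
      meets {τ} τ∈τs = definingSet-meets-trade dgdd defining τ b₁∈ b₂∈
          (flatten-distinct block₁ block₂ unique τ∈τs) swap₀₁b₁∉
        where
          b₁∈ = proj₁ (∈-flatten block₁ block₂ τ∈τs)
          b₂∈ = proj₂ (∈-flatten block₁ block₂ τ∈τs)
          x≢y : Trade.x τ ≢ Trade.y τ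
          x≢y = proj₁ (proj₁ dgdd (block₁ τ) b₁∈ 0F 1F λ ())
          swap₀₁b₁∉ : swap₀₁ (block₁ τ) ∉ tradeBlocks τs
          swap₀₁b₁∉ b₁′∈ = 4≰2 (subst (_≤ 2) (common-swap₀₁ (block₁ τ))
            (SuperSimple-∈ superSimple b₁∈ b₁′∈ (x≢y ∘ cong (λ b → lookup b 0F))))

-- Residues are naturals below 3t, so that the decision procedure below compares points with the
-- builtin _≡ᵇ_; `point` sends n to (n mod t , n div t), so the groups are the classes mod t.
record Residue (t : ℕ) : Set where
  constructor residue
  field
    value : ℕ
    .value<3t : value < 3 * t

open Residue using (value)

toResidue : ∀ {t} .{{_ : NonZero (3 * t)}} → ℕ → Residue t
toResidue {t} n = residue (n % (3 * t)) (m%n<n n (3 * t))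

mapTrade : ∀ {P Q : Set} → (P → Q) → Trade P → Trade Q
mapTrade f (trade x y a b c d) = trade (f x) (f y) (f a) (f b) (f c) (f d)

develop : ∀ {t} .{{_ : NonZero (3 * t)}} → ℕ → Trade ℕ → List (Trade (Residue t))
develop k τ = map (λ i → mapTrade (λ n → toResidue (n + i)) τ) (upTo k)

tradeBlocks-map : ∀ {P Q : Set} (f : P → Q) τs →
                  tradeBlocks (map (mapTrade f) τs) ≡ map (Vec.map f) (tradeBlocks τs)
tradeBlocks-map f []                         = refl
tradeBlocks-map f (trade x y a b c d ∷ τs) = cong (λ bs → _ ∷ _ ∷ bs) (tradeBlocks-map f τs)

module _ {t : ℕ} where

  point : Residue t → Point t
  point (residue n n<3t) = swap (remQuot t (fromℕ< n<3t))

  residueOf : Point t → Residue t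
  residueOf (g , k) = residue (toℕ (combine k g)) (Finₚ.toℕ<n (combine k g))

  point-residueOf : ∀ p → point (residueOf p) ≡ p
  point-residueOf (g , k) =
    trans (cong (swap ∘ remQuot t) (Finₚ.fromℕ<-toℕ (combine k g) _)) (cong swap (Finₚ.remQuot-combine k g))

  value-injective : ∀ {r s : Residue t} → value r ≡ value s → r ≡ s
  value-injective {residue m _} {residue .m _} refl = refl

  point-injective : ∀ {r s : Residue t} → point r ≡ point s → r ≡ s
  point-injective {residue m m<3t} {residue n n<3t} eq = value-injective (begin
    m                 ≡⟨ Finₚ.toℕ-fromℕ< m<3t ⟨
    toℕ (fromℕ< m<3t) ≡⟨ cong toℕ (remQuot-injective (cong swap eq)) ⟩
    toℕ (fromℕ< n<3t) ≡⟨ Finₚ.toℕ-fromℕ< n<3t ⟩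
    n                 ∎)
    where
      open ≡-Reasoning
      remQuot-injective : ∀ {i j : Fin (3 * t)} → remQuot t i ≡ remQuot t j → i ≡ j
      remQuot-injective {i} {j} eq′ =
        trans (sym (Finₚ.combine-remQuot t i)) (trans (cong (uncurry combine) eq′) (Finₚ.combine-remQuot t j))

  residueOf-point : ∀ r → residueOf (point r) ≡ r
  residueOf-point r = point-injective (point-residueOf (point r))

  decode : Vec (Residue t) 4 → Block t
  decode = Vec.map point

  _==_ : Residue t → Residue t → Bool
  r == s = value r ≡ᵇ value s

  ==⇔≡ : ∀ r s → T (r == s) ⇔ point r ≡ point s
  ==⇔≡ r s = mk⇔ (cong point ∘ value-injective ∘ ≡ᵇ⇒≡ _ _) (≡⇒≡ᵇ _ _ ∘ cong value ∘ point-injective)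

  _∈ᵇ_ : Residue t → Vec (Residue t) 4 → Bool
  r ∈ᵇ (p ∷ q ∷ s ∷ w ∷ []) = r == p ∨ r == q ∨ r == s ∨ r == w

  ∈ᵇ-any : ∀ r c → r ∈ᵇ c ≡ any (λ j → r == lookup c j) (allFin 4)
  ∈ᵇ-any r (p ∷ q ∷ s ∷ w ∷ []) = cong (λ z → r == p ∨ r == q ∨ r == s ∨ z) (sym (∨-identityʳ (r == w)))

  ∈ᵇ⇔ : ∀ r c → T (r ∈ᵇ c) ⇔ (∃ λ j → point r ≡ lookup (decode c) j)
  ∈ᵇ⇔ r c rewrite ∈ᵇ-any r c = mk⇔ to from
    where
      to : T (any (λ j → r == lookup c j) (allFin 4)) → ∃ λ j → point r ≡ lookup (decode c) j
      to r∈c with j , r≈cj ← satisfied (any⁻ (λ j → r == lookup c j) (allFin 4) r∈c) =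
        j , trans (Equivalence.to (==⇔≡ r (lookup c j)) r≈cj) (sym (lookup-map j point c))
      from : (∃ λ j → point r ≡ lookup (decode c) j) → T (any (λ j → r == lookup c j) (allFin 4))
      from (j , r≡cj) = any⁺ (λ j → r == lookup c j)
        (lose (∈-allFin j) (Equivalence.from (==⇔≡ r (lookup c j)) (trans r≡cj (lookup-map j point c))))

  lookup-∈ᵇ : ∀ b i → T (lookup b i ∈ᵇ b)
  lookup-∈ᵇ b i = Equivalence.from (∈ᵇ⇔ (lookup b i) b) (i , sym (lookup-map i point b))

  matches : Residue t → Residue t → Residue t × Residue t → Bool
  matches u v (p , q) = (p == u) ∧ (q == v)

  matches⇔ : ∀ u v pq → T (matches u v pq) ⇔ (point u , point v) ≡ Product.map point point pq
  matches⇔ u v (p , q) = mk⇔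
    (λ pq≈uv → let p≈u , q≈v = Equivalence.to T-∧ pq≈uv in
      sym (×-≡,≡→≡ (Equivalence.to (==⇔≡ p u) p≈u , Equivalence.to (==⇔≡ q v) q≈v)))
    (λ uv≡pq → let u≡p , v≡q = ×-≡,≡←≡ uv≡pq in
      Equivalence.from T-∧ (Equivalence.from (==⇔≡ p u) (sym u≡p) , Equivalence.from (==⇔≡ q v) (sym v≡q)))

  -- `any (matches u v) (pairs b)` with the tests of u factored out, which is cheaper to evaluate.
  pairInᵇ : Residue t → Residue t → Vec (Residue t) 4 → Bool
  pairInᵇ u v (p ∷ q ∷ r ∷ s ∷ []) =
    p == u ∧ (q == v ∨ r == v ∨ s == v) ∨ q == u ∧ (r == v ∨ s == v) ∨ r == u ∧ s == v

  pairInᵇ-any : ∀ u v b → pairInᵇ u v b ≡ any (matches u v) (pairs b)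
  pairInᵇ-any u v (p ∷ q ∷ r ∷ s ∷ []) =
    solve 6 (λ pu qu ru qv rv sv →
               pu :* (qv :+ (rv :+ sv)) :+ (qu :* (rv :+ sv) :+ ru :* sv)
            := pu :* qv :+ (pu :* rv :+ (pu :* sv :+ (qu :* rv :+ (qu :* sv :+ (ru :* sv :+ con false))))))
          refl (p == u) (q == u) (r == u) (q == v) (r == v) (s == v)
    where open ∨-∧-Solver

  pairInᵇ⇔ : ∀ u v b → T (pairInᵇ u v b) ⇔ PairIn (point u) (point v) (decode b)
  pairInᵇ⇔ u v b@(_ ∷ _ ∷ _ ∷ _ ∷ []) rewrite pairInᵇ-any u v b = mk⇔
    (λ uv∈b → ∈pairs⇒PairIn (decode b)
      (Anyₚ.map⁺ (Any.map (λ {pq} → Equivalence.to (matches⇔ u v pq)) (any⁻ (matches u v) (pairs b) uv∈b))))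
    (λ uv∈b → any⁺ (matches u v)
      (Any.map (λ {pq} → Equivalence.from (matches⇔ u v pq)) (Anyₚ.map⁻ (PairIn⇒∈pairs (decode b) uv∈b))))

  pairInᵇ⇒∈ᵇ : ∀ u v b → T (pairInᵇ u v b) → T (u ∈ᵇ b)
  pairInᵇ⇒∈ᵇ u v b uv∈b with i , _ , _ , bi≡u , _ ← Equivalence.to (pairInᵇ⇔ u v b) uv∈b =
    Equivalence.from (∈ᵇ⇔ u b) (i , sym bi≡u)

  commonᵇ : Vec (Residue t) 4 → Vec (Residue t) 4 → ℕ
  commonᵇ b c = count (_∈ᵇ c) (toList b)

  common-decode : ∀ b c → common (decode b) (decode c) ≡ commonᵇ b c
  common-decode b@(_ ∷ _ ∷ _ ∷ _ ∷ []) c =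
    length-filter-map (λ i → Finₚ.any? λ j → lookup (decode b) i ≟ₚ lookup (decode c) j) id
      (λ i → lookup b i ∈ᵇ c) bi∈c⇔ (allFin 4)
    where
      bi∈c⇔ : ∀ i → T (lookup b i ∈ᵇ c) ⇔ (∃ λ j → lookup (decode b) i ≡ lookup (decode c) j)
      bi∈c⇔ i = mk⇔
        (λ bi∈c → let j , bi≡cj = Equivalence.to (∈ᵇ⇔ (lookup b i) c) bi∈c in
          j , trans (lookup-map i point b) bi≡cj)
        (λ (j , bi≡cj) → Equivalence.from (∈ᵇ⇔ (lookup b i) c) (j , trans (sym (lookup-map i point b)) bi≡cj))

  fewCommonᵇ : Vec (Residue t) 4 → Vec (Residue t) 4 → Bool
  fewCommonᵇ b c = (commonᵇ b c ≤ᵇ 2) ∧ (commonᵇ c b ≤ᵇ 2)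

  fewCommon-decode : ∀ b c → T (fewCommonᵇ b c) → FewCommon (decode b) (decode c)
  fewCommon-decode b c few with bc≤2 , cb≤2 ← Equivalence.to T-∧ few =
    subst (_≤ 2) (sym (common-decode b c)) (≤ᵇ⇒≤ _ 2 bc≤2) ,
    subst (_≤ 2) (sym (common-decode c b)) (≤ᵇ⇒≤ _ 2 cb≤2)

  ¬fewCommonᵇ⇒shared : ∀ {b c} → ¬ T (fewCommonᵇ b c) → ∃ λ u → T (u ∈ᵇ b) × T (u ∈ᵇ c)
  ¬fewCommonᵇ⇒shared {b@(_ ∷ _ ∷ _ ∷ _ ∷ [])} {c@(_ ∷ _ ∷ _ ∷ _ ∷ [])} ¬few
    with commonᵇ b c ≤? 2 | commonᵇ c b ≤? 2
  ... | no bc≰2 | _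
    with i , bi∈c ← satisfied (count≢0⇒Any {p = λ i → lookup b i ∈ᵇ c} (allFin 4)
                                 λ bc≡0 → bc≰2 (subst (_≤ 2) (sym bc≡0) z≤n)) =
    lookup b i , lookup-∈ᵇ b i , bi∈c
  ... | _ | no cb≰2
    with j , cj∈b ← satisfied (count≢0⇒Any {p = λ j → lookup c j ∈ᵇ b} (allFin 4)
                                 λ cb≡0 → cb≰2 (subst (_≤ 2) (sym cb≡0) z≤n)) =
    lookup c j , cj∈b , lookup-∈ᵇ c j
  ... | yes bc≤2 | yes cb≤2 = ⊥-elim (¬few (Equivalence.from T-∧ (≤⇒≤ᵇ bc≤2 , ≤⇒≤ᵇ cb≤2)))

  through : Residue t → List (Vec (Residue t) 4) → List (Vec (Residue t) 4)
  through u = filterᵇ (u ∈ᵇ_)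

  allPoints? : ∀ {P : Point t → Set} → (∀ p → Dec (P p)) → Dec (∀ p → P p)
  allPoints? P? =
    map′ (λ all (g , k) → all g k) (λ all g k → all (g , k)) (Finₚ.all? λ g → Finₚ.all? λ k → P? (g , k))

  PairCountsAt : Point t → List (Vec (Residue t) 4) → Set
  PairCountsAt x L = ∀ y → group x ≢ group y → count (pairInᵇ (residueOf x) (residueOf y)) L ≡ 2

  pairCountsAt? : ∀ x L → Dec (PairCountsAt x L)
  pairCountsAt? x L = allPoints? λ y →
    ¬? (group x ≟ᶠ group y) →-dec (count (pairInᵇ (residueOf x) (residueOf y)) L ≟ℕ 2)

  -- Pair counts and super-simplicity are only checked among the blocks through each point: pairs
  -- starting at x lie in blocks through x, and two blocks with three common points share a point.
  LocalChecks : List (Vec (Residue t) 4) → Set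
  LocalChecks C = All (All DifferentGroups ∘ pairs ∘ decode) C
                × (∀ x → PairCountsAt x (through (residueOf x) C))
                × (∀ x → T (allPairsᵇ fewCommonᵇ (through (residueOf x) C)))

  localChecks? : ∀ C → Dec (LocalChecks C)
  localChecks? C =
    All.all? (λ b → All.all? (λ (p , q) → ¬? (group p ≟ᶠ group q)) (pairs (decode b))) C
    ×-dec allPoints? (λ x → pairCountsAt? x (through (residueOf x) C))
    ×-dec allPoints? (λ x → T? (allPairsᵇ fewCommonᵇ (through (residueOf x) C)))

  LocalChecks⇒IsDGDD : ∀ {C} → LocalChecks C → IsDGDD t (map decode C)
  LocalChecks⇒IsDGDD {C} (differ , counts , _) = valid , pairCounts
    where
      valid : ∀ b → b ∈ map decode C → ValidBlock b
      valid b b∈ with c , c∈C , refl ← ∈-map⁻ decode b∈ =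
        Equivalence.from (ValidBlock⇔pairs (decode c)) (All.lookup differ c∈C)
      pairCounts : ∀ x y → group x ≢ group y → pairCount x y (map decode C) ≡ 2
      pairCounts x y gx≢gy = begin
        pairCount x y (map decode C)                 ≡⟨ cong₂ (λ x y → pairCount x y (map decode C))
                                                          (point-residueOf x) (point-residueOf y) ⟨
        pairCount (point u) (point v) (map decode C) ≡⟨ length-filter-map (pairIn? (point u) (point v)) decode
                                                          (pairInᵇ u v) (pairInᵇ⇔ u v) C ⟩
        count (pairInᵇ u v) C                        ≡⟨ count-filterᵇ (pairInᵇ⇒∈ᵇ u v) C ⟨
        count (pairInᵇ u v) (through u C)            ≡⟨ counts x y gx≢gy ⟩
        2                                            ∎
        where
          open ≡-Reasoning
          u = residueOf x
          v = residueOf y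

  LocalChecks⇒SuperSimple : ∀ {C} → LocalChecks C → SuperSimple (map decode C)
  LocalChecks⇒SuperSimple {C} (_ , _ , fewCommon) =
    AllPairs⇒SuperSimple (AllPairsₚ.map⁺ {R = FewCommon} {f = decode}
      (AllPairs.map {R = FewCommonᵇ} (λ {b} {c} → fewCommon-decode b c)
        (AllPairs-local {R = FewCommonᵇ} (λ b c → T? (fewCommonᵇ b c)) _∈ᵇ_
          (λ {b} {c} → ¬fewCommonᵇ⇒shared {b} {c}) C local)))
    where
      FewCommonᵇ : Vec (Residue t) 4 → Vec (Residue t) 4 → Set
      FewCommonᵇ b c = T (fewCommonᵇ b c)
      local : ∀ u → AllPairs FewCommonᵇ (through u C)
      local u = allPairsᵇ-sound fewCommonᵇ (through u C)
        (subst (λ r → T (allPairsᵇ fewCommonᵇ (through r C))) (residueOf-point u) (fewCommon (point u)))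

cyclicDesign : ∀ {t} (τs : List (Trade (Residue t))) → True (localChecks? (tradeBlocks τs)) →
               ∃ λ (B : List (Block t)) → IsDGDD t B × SuperSimple B × HasDAtLeastHalf t B
cyclicDesign {t} τs checked = tradeBlocks τs′ , dgdd , superSimple , tradeBlocks-d≥½ τs′ dgdd superSimple
  where
    τs′ = map (mapTrade point) τs
    decoded : tradeBlocks τs′ ≡ map decode (tradeBlocks τs)
    decoded = tradeBlocks-map point τs
    dgdd = subst (IsDGDD t) (sym decoded) (LocalChecks⇒IsDGDD (toWitness checked))
    superSimple = subst SuperSimple (sym decoded) (LocalChecks⇒SuperSimple (toWitness checked))

-- For even t the first orbit is short: its second block is the translate of the first by 3t/2.
trades₆ : List (Trade (Residue 6))
trades₆ = develop 9 (trade 0 9 11 7 2 16) ++ develop 18 (trade 0 17 15 2 13 3)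
       ++ develop 18 (trade 0 17 10 7 9 4)

trades₇ : List (Trade (Residue 7))
trades₇ = develop 21 (trade 0 11 10 12 6 19) ++ develop 21 (trade 0 8 17 5 4 19)
       ++ develop 21 (trade 0 20 5 2 3 15)

trades₈ : List (Trade (Residue 8))
trades₈ = develop 12 (trade 0 12 18 3 6 15) ++ develop 24 (trade 0 4 14 17 23 5)
       ++ develop 24 (trade 0 9 4 11 14 7)  ++ develop 24 (trade 0 2 23 20 12 13)

trades₉ : List (Trade (Residue 9))
trades₉ = develop 27 (trade 0 11 24 7 25 17) ++ develop 27 (trade 0 7 15 19 2 12)
       ++ develop 27 (trade 0 22 6 3 25 21)  ++ develop 27 (trade 0 1 2 15 17 21)

trades₁₃ : List (Trade (Residue 13))
trades₁₃ = develop 39 (trade 0 16 5 35 2 33) ++ develop 39 (trade 0 28 24 22 32 3)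
        ++ develop 39 (trade 0 30 25 31 20 8) ++ develop 39 (trade 0 36 12 7 8 15)
        ++ develop 39 (trade 0 2 21 14 29 38) ++ develop 39 (trade 0 23 6 24 5 4)

lemma2 : (t : ℕ) → (t ≡ 6 ⊎ t ≡ 7 ⊎ t ≡ 8 ⊎ t ≡ 9 ⊎ t ≡ 13) →
    ∃ λ (B : List (Block t)) → IsDGDD t B × SuperSimple B × HasDAtLeastHalf t B
lemma2 _ (inj₁ refl)                      = cyclicDesign trades₆ tt
lemma2 _ (inj₂ (inj₁ refl))               = cyclicDesign trades₇ tt
lemma2 _ (inj₂ (inj₂ (inj₁ refl)))        = cyclicDesign trades₈ tt
lemma2 _ (inj₂ (inj₂ (inj₂ (inj₁ refl)))) = cyclicDesign trades₉ tt
lemma2 _ (inj₂ (inj₂ (inj₂ (inj₂ refl)))) = cyclicDesign trades₁₃ tt
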